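{- Let $\ddot{\mathbb A}$ be a relational BiKAT over a relational KAT $\mathbb A$ on $\Sigma$ that contains the top element $\mathbf{hav}=\Sigma\times\Sigma$. Let $c,d\in\mathbb A$ and let $R,S$ be relations on $\Sigma$ with $\dot R,\dot S$ tests of $\ddot{\mathbb A}$. If there exists $W\in\ddot{\mathbb A}$ such that (WCb) $W;\dot S\le \dot R;W;\dot S$, (WOb) $\langle c];\dot S\le [\mathbf{hav}\rangle;W$, and (WUb) $W;\dot S\le \langle\mathbf{hav}\mid d\rangle$, then the backward simulation $c\mid d:R\overset{\exists\leftarrow}{\approx>}S$ holds, i.e., $\forall\sigma,\tau,\tau'.\ \sigma\,c\,\tau\wedge\tau S\tau'\Rightarrow\exists\sigma'.\ \sigma R\sigma'\wedge\sigma'\,d\,\tau'$.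
   Context: A relational KAT on a set $\Sigma$: actions are relations on $\Sigma$, tests sub-identities, $1=id_\Sigma$, $0=\emptyset$, $;$ composition, $+$ union, ${}^*$ reflexive-transitive closure, $\neg p=id_\Sigma\setminus p$, $\le$ inclusion. A relational BiKAT over a relational KAT $\mathbb A$ on $\Sigma$ is a relational KAT $\ddot{\mathbb A}$ on $\Sigma\times\Sigma$ containing $\langle R]=R\otimes id_\Sigma$ and $[R\rangle=id_\Sigma\otimes R$ for every $R\in\mathbb A$ (where $(\sigma,\sigma')(R\otimes S)(\tau,\tau')$ iff $\sigma R\tau\wedge\sigma'S\tau'$), and whose left/right projections (existentially quantifying the other component of initial and final state pairs) lie in $\mathbb A$. $\langle c\mid d\rangle=\langle c];[d\rangle=c\otimes d$. For a relation $R$ on $\Sigma$, $\dot R$ is the sub-identity on $\Sigma\times\Sigma$ containing $((\sigma,\sigma'),(\sigma,\sigma'))$ iff $\sigma R\sigma'$. -}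

module Defs where

open import Level using (Level; 0ℓ) renaming (suc to lsuc)
open import Data.Product using (Σ; ∃; ∃-syntax; _×_; _,_)
open import Data.Sum using (_⊎_)
open import Data.Empty using (⊥)
open import Data.Unit using (⊤)
open import Relation.Nullary using (¬_)
open import Relation.Binary.PropositionalEquality using (_≡_)

Rel : Set → Set₁
Rel S = S → S → Set

module _ {S : Set} where

  _⊆_ : Rel S → Rel S → Set
  R ⊆ Q = ∀ {x y} → R x y → Q x y

  _≐_ : Rel S → Rel S → Set
  R ≐ Q = (R ⊆ Q) × (Q ⊆ R)

  idR : Rel S
  idR x y = x ≡ y

  emptyR : Rel S
  emptyR _ _ = ⊥

  hav : Rel S
  hav _ _ = ⊤

  _⨾_ : Rel S → Rel S → Rel S
  (R ⨾ Q) x z = ∃[ y ] (R x y × Q y z)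

  _∪_ : Rel S → Rel S → Rel S
  (R ∪ Q) x y = R x y ⊎ Q x y

  data Star (R : Rel S) : Rel S where
    ε   : ∀ {x} → Star R x x
    _◅_ : ∀ {x y z} → R x y → Star R y z → Star R x z

  negT : Rel S → Rel S
  negT p x y = (x ≡ y) × ¬ p x y

  IsSubId : Rel S → Set
  IsSubId p = p ⊆ idR

-- A relational KAT on Σ: a set of relations on Σ (given by its membership
-- predicate, closed under extensional equality) containing 1 and 0, closed
-- under ;, +, *, and negation of tests (tests = sub-identities in the set).
record RelKAT (S : Set) : Set₂ where
  field
    mem      : Rel S → Set₁
    mem-resp : ∀ {R Q} → R ≐ Q → mem R → mem Q
    mem-id   : mem idR
    mem-0    : mem emptyR
    mem-seq  : ∀ {R Q} → mem R → mem Q → mem (R ⨾ Q)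
    mem-+    : ∀ {R Q} → mem R → mem Q → mem (R ∪ Q)
    mem-*    : ∀ {R} → mem R → mem (Star R)
    mem-neg  : ∀ {p} → IsSubId p → mem p → mem (negT p)

  IsTest : Rel S → Set₁
  IsTest p = IsSubId p × mem p

open RelKAT public

module _ {S : Set} where

  _⊗_ : Rel S → Rel S → Rel (S × S)
  (R ⊗ Q) (σ , σ') (τ , τ') = R σ τ × Q σ' τ'

  ⟨_] : Rel S → Rel (S × S)
  ⟨ R ] = R ⊗ idR

  [_⟩ : Rel S → Rel (S × S)
  [ R ⟩ = idR ⊗ R

  ⟨_∣_⟩ : Rel S → Rel S → Rel (S × S)
  ⟨ c ∣ d ⟩ = c ⊗ d

  leftProj : Rel (S × S) → Rel S
  leftProj X σ τ = ∃[ σ' ] ∃[ τ' ] X (σ , σ') (τ , τ')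

  rightProj : Rel (S × S) → Rel S
  rightProj X σ' τ' = ∃[ σ ] ∃[ τ ] X (σ , σ') (τ , τ')

  dot : Rel S → Rel (S × S)
  dot R (σ , σ') (τ , τ') = ((σ , σ') ≡ (τ , τ')) × R σ σ'

record RelBiKAT {S : Set} (A : RelKAT S) : Set₂ where
  field
    kat       : RelKAT (S × S)
    mem-left  : ∀ {R} → mem A R → mem kat ⟨ R ]
    mem-right : ∀ {R} → mem A R → mem kat [ R ⟩
    proj-left  : ∀ {X} → mem kat X → mem A (leftProj X)
    proj-right : ∀ {X} → mem kat X → mem A (rightProj X)

open RelBiKAT public

BackSim : {S : Set} → Rel S → Rel S → Rel S → Rel S → Set
BackSim c d R Q = ∀ σ τ τ' → c σ τ → Q τ τ' → ∃[ σ' ] (R σ σ' × d σ' τ')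

{-# OPTIONS --safe #-}
module Submission where

open import Defs
open import Data.Product using (∃; ∃-syntax; _×_; _,_; proj₂)
open import Relation.Binary.PropositionalEquality using (refl)

-- Only the three inclusions matter; no closure property of the (Bi)KAT is used.
-- From σ c τ and τ Q τ', WOb yields σ' with (σ,σ') W (τ,τ'); this pair lies in
-- W ⨾ Q̇, so WCb forces σ R σ' and WUb gives σ' d τ'.

module _ {S : Set} where

  ⨾dot-intro : (X : Rel (S × S)) {Q : Rel S} {p : S × S} {τ τ' : S} →
    X p (τ , τ') → Q τ τ' → (X ⨾ dot Q) p (τ , τ')
  ⨾dot-intro X x q = _ , x , refl , q

  dot-⨾-source : (R : Rel S) (X Y : Rel (S × S)) {σ σ' : S} {t : S × S} →
    ((dot R ⨾ X) ⨾ Y) (σ , σ') t → R σ σ'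
  dot-⨾-source R X Y (_ , (_ , (refl , r) , _) , _) = r

  backSim-of-inclusions : (W : Rel (S × S)) (c d R Q : Rel S) →
    (W ⨾ dot Q) ⊆ ((dot R ⨾ W) ⨾ dot Q) →
    (⟨ c ] ⨾ dot Q) ⊆ ([ hav ⟩ ⨾ W) →
    (W ⨾ dot Q) ⊆ ⟨ hav ∣ d ⟩ →
    BackSim c d R Q
  backSim-of-inclusions W c d R Q wcb wob wub σ τ τ' cστ Qττ'
    with wob (_ , (cστ , refl) , (refl , Qττ'))
  ... | (_ , σ') , (refl , _) , w =
    σ' , dot-⨾-source R W (dot Q) (wcb Wq) , proj₂ (wub Wq)
    where
    Wq : (W ⨾ dot Q) (σ , σ') (τ , τ')
    Wq = ⨾dot-intro W w Qττ'

theorem7p2 : {S : Set} (A : RelKAT S) (B : RelBiKAT A) →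
    mem A hav →
    (c d R Q : Rel S) → mem A c → mem A d →
    IsTest (kat B) (dot R) → IsTest (kat B) (dot Q) →
    (∃[ W ] (mem (kat B) W
    × ((W ⨾ dot Q) ⊆ ((dot R ⨾ W) ⨾ dot Q))
    × ((⟨ c ] ⨾ dot Q) ⊆ ([ hav ⟩ ⨾ W))
    × ((W ⨾ dot Q) ⊆ ⟨ hav ∣ d ⟩))) →
    BackSim c d R Q
theorem7p2 A B _ c d R Q _ _ _ _ (W , _ , wcb , wob , wub) =
  backSim-of-inclusions W c d R Q wcb wob wub
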